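{- Given $a\ne b$ in $\mathbf{Z}_{2n+1}$ there exists an endomorphism $h$ of $\mathbf{Z}_{2n+1}$ such that either $\delta^+(h(a))\ne\delta^+(h(b))$ or $\delta^-(h(a))\ne\delta^-(h(b))$.
   Context: $\mathbf{Z}_{2n+1}$ is the Sugihara algebra on $\{ -n,\ldots,n\}$ (lattice order of integers, $\neg a=-a$, $a\to b=(-a)\vee b$ if $a\le b$, $(-a)\wedge b$ otherwise). $\delta^+,\delta^-$ are the lattice homomorphisms from the lattice reduct of $\mathbf{Z}_{2n+1}$ to the two-element lattice $\{0,1\}$ given by $\delta^+(a)=1\iff a\ge1$ and $\delta^-(a)=1\iff a\ge0$. -}

module Defs where

open import Data.Nat using (ℕ)
open import Data.Integer using (ℤ; +_; -_; _⊓_; _⊔_; ∣_∣; _≤_; _≤?_)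
open import Data.Integer.Properties using (∣-i∣≡∣i∣)
import Data.Nat as ℕ
import Data.Nat.Properties as ℕP
open import Data.Product using (Σ; _,_; proj₁)
open import Data.Bool using (Bool; true; false)
open import Relation.Nullary using (does; yes; no)
open import Relation.Binary.PropositionalEquality using (_≡_; subst; sym)

-- Carrier of the Sugihara algebra Z_{2n+1}: integers a with |a| ≤ n.
Z : ℕ → Set
Z n = Σ ℤ (λ a → ∣ a ∣ ℕ.≤ n)

val : ∀ {n} → Z n → ℤ
val = proj₁

_∧_ : ∀ {n} → Z n → Z n → Z n
x ∧ y with val x ≤? val y
... | yes _ = x
... | no _ = y

_∨_ : ∀ {n} → Z n → Z n → Z n
x ∨ y with val x ≤? val y
... | yes _ = y
... | no _ = x

¬_ : ∀ {n} → Z n → Z n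
¬ (a , p) = (- a) , subst (ℕ._≤ _) (sym (∣-i∣≡∣i∣ a)) p

_⇒_ : ∀ {n} → Z n → Z n → Z n
x ⇒ y with val x ≤? val y
... | yes _ = (¬ x) ∨ y
... | no _ = (¬ x) ∧ y

record IsEndo {n : ℕ} (h : Z n → Z n) : Set where
  field
    pres-∧ : ∀ x y → val (h (x ∧ y)) ≡ val (h x ∧ h y)
    pres-∨ : ∀ x y → val (h (x ∨ y)) ≡ val (h x ∨ h y)
    pres-¬ : ∀ x → val (h (¬ x)) ≡ val (¬ h x)
    pres-⇒ : ∀ x y → val (h (x ⇒ y)) ≡ val (h x ⇒ h y)

δ⁺ : ∀ {n} → Z n → Bool
δ⁺ x = does (+ 1 ≤? val x)

δ⁻ : ∀ {n} → Z n → Bool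
δ⁻ x = does (+ 0 ≤? val x)

-- For c : ℕ let  shrink c  move every integer c steps towards 0,
-- stopping at 0 (so shrink c a = sign(a)·max(|a| − c, 0)).  This map is
-- monotone, odd, does not increase absolute values, and it identifies two
-- distinct integers only by sending both to 0.  We call maps with these four
-- properties squeezes and show that every squeeze restricts to an
-- endomorphism of Z_{2n+1}: monotonicity gives preservation of ∧ and ∨,
-- oddness of ¬, and the "merge only at 0" property handles → in the one case
-- where the order of the arguments is not preserved.
--
-- Given a < b, a suitable shrink c pushes a onto or across one of the
-- thresholds of δ⁺ (namely 1) or δ⁻ (namely 0) while b stays on the upper
-- side: if 0 < a take c = a, if a < 0 ≤ b take c = 0, and if a < b < 0
-- take c = |b|.
module Submission where

open import Defs
open import Data.Nat using (ℕ)
open import Data.Product using (Σ; _×_)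
open import Data.Sum using (_⊎_)
open import Relation.Binary.PropositionalEquality using (_≢_)

import Data.Nat as ℕ
import Data.Nat.Properties as ℕP
open import Data.Integer as ℤ using (ℤ; +_; -[1+_]; -_; _⊓_; _⊔_; ∣_∣; _≤?_; +≤+; -≤-; -≤+; +<+; -<+; -<-)
open import Data.Integer.Properties as ℤP using (∣-i∣≡∣i∣; neg-involutive; neg-≤-pos; neg-mono-≤; neg-mono-<; ≤-antisym; ≰⇒>; <⇒≤; <⇒≱; <-cmp)
open import Algebra.Construct.NaturalChoice.MinMaxOp ℤP.⊓-operator ℤP.⊔-operator using (mono-≤-distrib-⊓; mono-≤-distrib-⊔)
open import Data.Product using (_,_)
open import Data.Sum using (inj₁; inj₂) renaming (map to ⊎-map)
open import Data.Empty using (⊥-elim)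
open import Relation.Nullary using (does; yes; no; contradiction)
open import Relation.Nullary.Decidable using (dec-true; dec-false)
open import Relation.Binary.Core using (_Preserves_⟶_)
open import Relation.Binary.Definitions using (tri<; tri≈; tri>)
open import Relation.Binary.PropositionalEquality using (_≡_; refl; sym; trans; cong; cong₂; subst; ≢-sym; module ≡-Reasoning)

imp : ℤ → ℤ → ℤ
imp i j with i ≤? j
... | yes _ = (- i) ⊔ j
... | no _ = (- i) ⊓ j

val-∧ : ∀ {n} (x y : Z n) → val (x ∧ y) ≡ val x ⊓ val y
val-∧ x y with val x ≤? val y
... | yes x≤y = sym (ℤP.i≤j⇒i⊓j≡i x≤y)
... | no x≰y = sym (ℤP.i≥j⇒i⊓j≡j (<⇒≤ (≰⇒> x≰y)))

val-∨ : ∀ {n} (x y : Z n) → val (x ∨ y) ≡ val x ⊔ val y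
val-∨ x y with val x ≤? val y
... | yes x≤y = sym (ℤP.i≤j⇒i⊔j≡j x≤y)
... | no x≰y = sym (ℤP.i≥j⇒i⊔j≡i (<⇒≤ (≰⇒> x≰y)))

val-⇒ : ∀ {n} (x y : Z n) → val (x ⇒ y) ≡ imp (val x) (val y)
val-⇒ x y with val x ≤? val y
... | yes _ = val-∨ (¬ x) y
... | no _ = val-∧ (¬ x) y

record IsSqueeze (f : ℤ → ℤ) : Set where
  field
    mono : f Preserves ℤ._≤_ ⟶ ℤ._≤_
    odd : ∀ i → f (- i) ≡ - f i
    contracting : ∀ i → ∣ f i ∣ ℕ.≤ ∣ i ∣
    merges-only-at-0 : ∀ {i j} → i ℤ.< j → f i ≡ f j → f j ≡ + 0

-- Squeezes commute with imp.  If f reverses the strict order of i > j then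
-- f i = f j = 0 and both sides of the equation are 0.

module _ {f : ℤ → ℤ} (sq : IsSqueeze f) where
  open IsSqueeze sq

  imp-squeeze : ∀ i j → f (imp i j) ≡ imp (f i) (f j)
  imp-squeeze i j with i ≤? j | f i ≤? f j
  ... | yes _ | yes _ = trans (mono-≤-distrib-⊔ (cong f) mono (- i) j) (cong (_⊔ f j) (odd i))
  ... | yes i≤j | no fi≰fj = contradiction (mono i≤j) fi≰fj
  ... | no _ | no _ = trans (mono-≤-distrib-⊓ (cong f) mono (- i) j) (cong (_⊓ f j) (odd i))
  ... | no i≰j | yes fi≤fj = begin
      f ((- i) ⊓ j)       ≡⟨ mono-≤-distrib-⊓ (cong f) mono (- i) j ⟩
      f (- i) ⊓ f j       ≡⟨ cong (_⊓ f j) (odd i) ⟩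
      (- f i) ⊓ f j       ≡⟨ cong₂ (λ u v → (- u) ⊓ v) fi≡0 fj≡0 ⟩
      + 0                 ≡⟨ sym (cong₂ (λ u v → (- u) ⊔ v) fi≡0 fj≡0) ⟩
      (- f i) ⊔ f j       ∎
    where
    open ≡-Reasoning
    j<i : j ℤ.< i
    j<i = ≰⇒> i≰j
    fj≡fi : f j ≡ f i
    fj≡fi = ≤-antisym (mono (<⇒≤ j<i)) fi≤fj
    fi≡0 : f i ≡ + 0
    fi≡0 = merges-only-at-0 j<i fj≡fi
    fj≡0 : f j ≡ + 0
    fj≡0 = trans fj≡fi fi≡0

restrict : ∀ {n f} → IsSqueeze f → Z n → Z n
restrict {f = f} sq (a , |a|≤n) = f a , ℕP.≤-trans (IsSqueeze.contracting sq a) |a|≤n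

restrict-isEndo : ∀ {n f} (sq : IsSqueeze f) → IsEndo (restrict {n} sq)
restrict-isEndo {f = f} sq = record
  { pres-∧ = λ x y → begin
      f (val (x ∧ y))           ≡⟨ cong f (val-∧ x y) ⟩
      f (val x ⊓ val y)         ≡⟨ mono-≤-distrib-⊓ (cong f) mono (val x) (val y) ⟩
      f (val x) ⊓ f (val y)     ≡⟨ sym (val-∧ (h x) (h y)) ⟩
      val (h x ∧ h y)           ∎
  ; pres-∨ = λ x y → begin
      f (val (x ∨ y))           ≡⟨ cong f (val-∨ x y) ⟩
      f (val x ⊔ val y)         ≡⟨ mono-≤-distrib-⊔ (cong f) mono (val x) (val y) ⟩
      f (val x) ⊔ f (val y)     ≡⟨ sym (val-∨ (h x) (h y)) ⟩
      val (h x ∨ h y)           ∎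
  ; pres-¬ = λ x → odd (val x)
  ; pres-⇒ = λ x y → begin
      f (val (x ⇒ y))           ≡⟨ cong f (val-⇒ x y) ⟩
      f (imp (val x) (val y))   ≡⟨ imp-squeeze sq (val x) (val y) ⟩
      imp (f (val x)) (f (val y)) ≡⟨ sym (val-⇒ (h x) (h y)) ⟩
      val (h x ⇒ h y)           ∎
  }
  where
  open ≡-Reasoning
  open IsSqueeze sq
  h = restrict sq

shrink : ℕ → ℤ → ℤ
shrink c (+ m) = + (m ℕ.∸ c)
shrink c -[1+ m ] = - (+ (ℕ.suc m ℕ.∸ c))

∸-merges-only-at-0 : ∀ {m' m} c → m' ℕ.< m → m ℕ.∸ c ≡ m' ℕ.∸ c → m ℕ.∸ c ≡ 0
∸-merges-only-at-0 ℕ.zero m'<m eq = contradiction (sym eq) (ℕP.<⇒≢ m'<m)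
∸-merges-only-at-0 {m = ℕ.zero} (ℕ.suc c) m'<m eq = refl
∸-merges-only-at-0 {ℕ.zero} {ℕ.suc m} (ℕ.suc c) m'<m eq = eq
∸-merges-only-at-0 {ℕ.suc m'} {ℕ.suc m} (ℕ.suc c) (ℕ.s≤s m'<m) eq = ∸-merges-only-at-0 c m'<m eq

+≡-+⇒+≡0 : ∀ a k → + a ≡ - (+ k) → + a ≡ + 0
+≡-+⇒+≡0 a ℕ.zero eq = eq
+≡-+⇒+≡0 a (ℕ.suc k) ()

shrink-isSqueeze : ∀ c → IsSqueeze (shrink c)
shrink-isSqueeze c = record
  { mono = mono
  ; odd = odd
  ; contracting = contracting
  ; merges-only-at-0 = merges
  }
  where
  mono : shrink c Preserves ℤ._≤_ ⟶ ℤ._≤_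
  mono (-≤- n≤m) = neg-mono-≤ (+≤+ (ℕP.∸-monoˡ-≤ c (ℕ.s≤s n≤m)))
  mono -≤+ = neg-≤-pos
  mono (+≤+ m≤n) = +≤+ (ℕP.∸-monoˡ-≤ c m≤n)

  odd : ∀ i → shrink c (- i) ≡ - shrink c i
  odd (+ ℕ.zero) rewrite ℕP.0∸n≡0 c = refl
  odd (+ ℕ.suc m) = refl
  odd -[1+ m ] = sym (neg-involutive _)

  contracting : ∀ i → ∣ shrink c i ∣ ℕ.≤ ∣ i ∣
  contracting (+ m) = ℕP.m∸n≤m m c
  contracting -[1+ m ] =
    subst (ℕ._≤ ℕ.suc m) (sym (∣-i∣≡∣i∣ (+ (ℕ.suc m ℕ.∸ c)))) (ℕP.m∸n≤m (ℕ.suc m) c)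

  merges : ∀ {i j} → i ℤ.< j → shrink c i ≡ shrink c j → shrink c j ≡ + 0
  merges (+<+ m'<m) eq = cong +_ (∸-merges-only-at-0 c m'<m (ℤP.+-injective (sym eq)))
  merges { -[1+ m' ]} {+ m} -<+ eq = +≡-+⇒+≡0 (m ℕ.∸ c) (ℕ.suc m' ℕ.∸ c) (sym eq)
  merges { -[1+ m' ]} { -[1+ m ]} (-<- m<m') eq =
    trans (sym eq) (cong (λ k → - (+ k))
      (∸-merges-only-at-0 c (ℕ.s≤s m<m') (ℤP.+-injective (ℤP.neg-injective eq))))

Straddle : ℤ → ℤ → ℤ → Set
Straddle t i j = i ℤ.< t × t ℤ.≤ j

shrink-separates : ∀ {i j} → i ℤ.< j →
  Σ ℕ (λ c → Straddle (+ 1) (shrink c i) (shrink c j) ⊎ Straddle (+ 0) (shrink c i) (shrink c j))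
shrink-separates (+<+ {m} m<m') =
  m , inj₁ (+<+ (ℕ.s≤s (ℕP.≤-reflexive (ℕP.n∸n≡0 m))) , +≤+ (ℕP.m<n⇒0<n∸m m<m'))
shrink-separates -<+ = 0 , inj₂ (-<+ , +≤+ ℕ.z≤n)
shrink-separates (-<- {m} {m'} m'<m) =
  ℕ.suc m' , inj₂ ( neg-mono-< (+<+ (ℕP.m<n⇒0<n∸m m'<m))
                  , ℤP.≤-reflexive (sym (cong (λ k → - (+ k)) (ℕP.n∸n≡0 m'))))

threshold-separates : ∀ t {i j} → Straddle t i j → does (t ≤? i) ≢ does (t ≤? j)
threshold-separates t {i} {j} (i<t , t≤j)
  rewrite dec-false (t ≤? i) (<⇒≱ i<t) | dec-true (t ≤? j) t≤j = λ ()

DeltaSeparated : ∀ {n} → Z n → Z n → Set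
DeltaSeparated x y = δ⁺ x ≢ δ⁺ y ⊎ δ⁻ x ≢ δ⁻ y

DeltaSeparated-sym : ∀ {n} {x y : Z n} → DeltaSeparated x y → DeltaSeparated y x
DeltaSeparated-sym = ⊎-map ≢-sym ≢-sym

separate-ordered : ∀ {n} (a b : Z n) → val a ℤ.< val b →
  Σ (Z n → Z n) (λ h → IsEndo h × DeltaSeparated (h a) (h b))
separate-ordered a b a<b with shrink-separates a<b
... | c , st = restrict sq , restrict-isEndo sq ,
               ⊎-map (threshold-separates (+ 1)) (threshold-separates (+ 0)) st
  where
  sq = shrink-isSqueeze c

lemma4p1 : (n : ℕ) (a b : Z n) → val a ≢ val b →
    Σ (Z n → Z n) (λ h → IsEndo h × (δ⁺ (h a) ≢ δ⁺ (h b) ⊎ δ⁻ (h a) ≢ δ⁻ (h b)))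
lemma4p1 n a b a≢b with <-cmp (val a) (val b)
... | tri< a<b _ _ = separate-ordered a b a<b
... | tri≈ _ a≡b _ = ⊥-elim (a≢b a≡b)
... | tri> _ _ b<a with separate-ordered b a b<a
...   | h , endo , sep = h , endo , DeltaSeparated-sym {x = h b} {y = h a} sep
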